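{- Let $A$ be a nondeterministic Büchi automaton over $2^{I\cup O}$ with states $S = \{s_0,\dots,s_{k-1}\}$, initial state $s_0$, every state and transition lying on an accepting run, and let $X \subseteq O$ be automata dependent on $I \cup (O\setminus X)$ in $A$. Consider the sequential circuit with state bits $p_0,\dots,p_{k-1}$, inputs $I \cup (O\setminus X)$, next-state function $\Delta^X$ with $n_i = \bigvee_{s_j \in in(s_i)} \big(p_j \wedge \exists X\, B_{(s_j,s_i)}\big)$ for $i = 0,\dots,k-1$, and output function $\Lambda^X$ whose output for $x_i \in X$ is $\bigvee_{(s,s')} \big(p_s \wedge B_{(s,s')}[X \mapsto F^{(s,s')}] \wedge F^{(s,s')}_i\big)$ over all transitions $(s,s')$, where $F^{(s,s')}$ are as described below. Assume (a) the initial state is $p_0 = 1$ and $p_j = 0$ for $j = 1,\dots,k-1$, and (b) the output is interpreted as $\bot$ whenever $\bigvee_{i=0}^{k-1} n_i$ evaluates to $0$. Then this circuit is a correct implementation of the transducer $T_X$: on every sequence of input letters from $\Sigma_I \times \Sigma_{O\setminus X}$ it produces the same sequence of outputs as $T_X$.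
   Context: $\Sigma_Z = 2^Z$; letters are triples $(\sigma_I,\sigma,\sigma') \in \Sigma_I\times\Sigma_{O\setminus X}\times\Sigma_X$. $B_{(s,s')}$ is the Boolean function over $I \cup O$ whose satisfying assignments are the letters $a$ with $s' \in \delta(s,a)$; $in(s_i)$ is the set of states with a transition to $s_i$; $p_s = p_j$ for $s = s_j$. At each step the circuit reads an input letter, produces outputs from the current $p$ and the input, and updates $p_i := n_i$. For each transition $(s,s')$, $F^{(s,s')} = \langle F^{(s,s')}_1,\dots,F^{(s,s')}_{|X|}\rangle$ are Boolean functions over $I\cup(O\setminus X)$ such that for every assignment to $I \cup (O\setminus X)$, $\exists X\, B_{(s,s')}$ implies $B_{(s,s')}[X \mapsto F^{(s,s')}]$. The transducer $T_X$ has state set $2^S$, initial state $\{s_0\}$, transition $\delta^X(U,(\sigma_I,\sigma)) = \{q' \mid \exists q \in U\ \exists\sigma' \in \Sigma_X : q' \in \delta(q,(\sigma_I,\sigma,\sigma'))\}$, and output $\lambda^X(U,(\sigma_I,\sigma))$ equal to the unique $\sigma_X$ with $\delta^X(U,(\sigma_I,\sigma)) = \{q' \mid \exists q\in U: q' \in \delta(q,(\sigma_I,\sigma,\sigma_X))\}$ if $\delta^X(U,(\sigma_I,\sigma)) \ne \emptyset$, and $\bot$ otherwise. A pair of states is compatible if some finite word has runs from $s_0$ to both. $X$ is automata dependent on $Y$ if for every compatible pair $(s,s')$ and letters $a,a'$ agreeing on $Y$ but not on $X$, not both $\delta(s,a)$ and $\delta(s',a')$ are nonempty. -}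

module Defs where

open import Data.Bool using (Bool; true; false; _∧_; _∨_; if_then_else_)
open import Data.Nat using (ℕ; zero; suc; _≤_)
open import Data.Fin using (Fin; zero; suc)
open import Data.Vec using (Vec; []; _∷_; lookup; tabulate)
open import Data.List using (List; []; _∷_; _++_; map)
open import Data.Bool.ListAction using (any)
open import Data.Product using (_×_; _,_; Σ; ∃; ∃-syntax)
open import Data.Maybe using (Maybe; just; nothing)
open import Relation.Binary.PropositionalEquality using (_≡_; _≢_)
open import Relation.Nullary using (¬_)

-- Variables and assignments.  A set of Boolean variables Z of size n is
-- Fin n; Σ_Z = 2^Z is the set of assignments Vec Bool n.

Assign : ℕ → Set
Assign n = Vec Bool n

allAssign : (n : ℕ) → List (Assign n)
allAssign zero    = [] ∷ []
allAssign (suc n) = map (true ∷_) (allAssign n) ++ map (false ∷_) (allAssign n)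

existsB : (n : ℕ) → (Assign n → Bool) → Bool
existsB n f = any f (allAssign n)

orFin : (k : ℕ) → (Fin k → Bool) → Bool
orFin zero    f = false
orFin (suc k) f = f zero ∨ orFin k (λ j → f (suc j))

-- Letters: triples (σ_I, σ, σ') ∈ Σ_I × Σ_{O∖X} × Σ_X, where
-- |I| = nI, |O∖X| = nO, |X| = nX.

Letter : ℕ → ℕ → ℕ → Set
Letter nI nO nX = Assign nI × Assign nO × Assign nX

InLetter : ℕ → ℕ → Set
InLetter nI nO = Assign nI × Assign nO

-- Nondeterministic Büchi automaton with states S = Fin (suc k)
-- (i.e. s_0, …, s_k), initial state s_0 = zero, transition relation δ
-- (s' ∈ δ(s,a) iff δ s a s' ≡ true), and accepting states acc.
record NBA (nI nO nX k : ℕ) : Set where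
  field
    δ   : Fin (suc k) → Letter nI nO nX → Fin (suc k) → Bool
    acc : Fin (suc k) → Bool

module _ {nI nO nX k : ℕ} (A : NBA nI nO nX k) where
  open NBA A

  State : Set
  State = Fin (suc k)

  s₀ : State
  s₀ = zero

  record AccRun : Set where
    field
      word    : ℕ → Letter nI nO nX
      run     : ℕ → State
      start   : run 0 ≡ s₀
      step    : ∀ t → δ (run t) (word t) (run (suc t)) ≡ true
      infAcc  : ∀ N → ∃[ t ] (N ≤ t × acc (run t) ≡ true)

  StateOnAccRun : State → Set
  StateOnAccRun s = Σ AccRun λ ρ → ∃[ t ] AccRun.run ρ t ≡ s

  TransOnAccRun : State → Letter nI nO nX → State → Set
  TransOnAccRun s a s' = Σ AccRun λ ρ → ∃[ t ]
    (AccRun.run ρ t ≡ s × AccRun.word ρ t ≡ a × AccRun.run ρ (suc t) ≡ s')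

  AllOnAccRuns : Set
  AllOnAccRuns = (∀ s → StateOnAccRun s)
               × (∀ s a s' → δ s a s' ≡ true → TransOnAccRun s a s')

  -- Reach w s : there is a run from s₀ on the finite word w ending in s.
  -- (Words are stored last-letter-first.)
  data Reach : List (Letter nI nO nX) → State → Set where
    reach[] : Reach [] s₀
    reach∷  : ∀ {w s a s'} → Reach w s → δ s a s' ≡ true → Reach (a ∷ w) s'

  Compatible : State → State → Set
  Compatible s s' = ∃[ w ] (Reach w s × Reach w s')

  NonEmptyδ : State → Letter nI nO nX → Set
  NonEmptyδ s a = ∃[ q ] δ s a q ≡ true

  AutomataDependent : Set
  AutomataDependent =
    ∀ s s' → Compatible s s' →
    ∀ (σI : Assign nI) (σ : Assign nO) (σX σX' : Assign nX) →
    σX ≢ σX' → ¬ (NonEmptyδ s (σI , σ , σX) × NonEmptyδ s' (σI , σ , σX'))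

  B : State → State → Assign nI → Assign nO → Assign nX → Bool
  B s s' σI σ σX = δ s (σI , σ , σX) s'

  ∃XB : State → State → Assign nI → Assign nO → Bool
  ∃XB s s' σI σ = existsB nX (B s s' σI σ)

  -- (s, s') is a transition (s' ∈ δ(s,a) for some letter a);
  -- equivalently s ∈ in(s')
  isTrans : State → State → Bool
  isTrans s s' = existsB nI λ σI → existsB nO λ σ → existsB nX λ σX → B s s' σI σ σX

  SkolemSpec : (State → State → Assign nI → Assign nO → Assign nX) → Set
  SkolemSpec F = ∀ s s' σI σ → ∃XB s s' σI σ ≡ true → B s s' σI σ (F s s' σI σ) ≡ true

  CState : Set
  CState = State → Bool

  ΔX : CState → InLetter nI nO → CState
  ΔX p (σI , σ) i = orFin (suc k) λ j → isTrans j i ∧ (p j ∧ ∃XB j i σI σ)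

  ΛX : (State → State → Assign nI → Assign nO → Assign nX) →
       CState → InLetter nI nO → Assign nX
  ΛX F p (σI , σ) = tabulate λ m →
    orFin (suc k) λ s → orFin (suc k) λ s' →
      isTrans s s' ∧ (p s ∧ (B s s' σI σ (F s s' σI σ) ∧ lookup (F s s' σI σ) m))

  cInit : CState
  cInit zero    = true
  cInit (suc _) = false

  cState : (ℕ → InLetter nI nO) → ℕ → CState
  cState w zero    = cInit
  cState w (suc t) = ΔX (cState w t) (w t)

  cOut : (State → State → Assign nI → Assign nO → Assign nX) →
         (ℕ → InLetter nI nO) → ℕ → Maybe (Assign nX)
  cOut F w t =
    if orFin (suc k) (ΔX (cState w t) (w t))
    then just (ΛX F (cState w t) (w t))
    else nothing

  -- The transducer T_X (states 2^S, subsets as characteristic functions)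

  TState : Set
  TState = State → Bool

  δX : TState → InLetter nI nO → TState
  δX U (σI , σ) q' = orFin (suc k) λ q → U q ∧ existsB nX λ σX → δ q (σI , σ , σX) q'

  stepWith : TState → InLetter nI nO → Assign nX → TState
  stepWith U (σI , σ) σX q' = orFin (suc k) λ q → U q ∧ δ q (σI , σ , σX) q'

  tInit : TState
  tInit zero    = true
  tInit (suc _) = false

  tState : (ℕ → InLetter nI nO) → ℕ → TState
  tState w zero    = tInit
  tState w (suc t) = δX (tState w t) (w t)

  -- λ^X(U, ι) = o, as a relation: o = ⊥ iff δ^X(U,ι) = ∅; otherwise o is
  -- the unique σ_X with δ^X(U,ι) = {q' | ∃ q ∈ U : q' ∈ δ(q,(ι,σ_X))}.
  IsλX : TState → InLetter nI nO → Maybe (Assign nX) → Set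
  IsλX U ι nothing   = ∀ q' → δX U ι q' ≡ false
  IsλX U ι (just σX) =
    (∃[ q' ] δX U ι q' ≡ true)
    × (∀ q' → δX U ι q' ≡ stepWith U ι σX q')
    × (∀ σX' → (∀ q' → δX U ι q' ≡ stepWith U ι σX' q') → σX' ≡ σX)

{-# OPTIONS --safe #-}
-- The circuit state p is the characteristic vector of the transducer state U,
-- because the guard "s_j ∈ in(s_i)" in n_i is implied by ∃X B_(s_j,s_i).  All
-- states of U are reached from s₀ by one common finite word, so they are pairwise
-- compatible and, by automata dependence, all transitions leaving U on the same
-- input (σ_I, σ) carry the same X-part σ₀.  Hence δ^X(U, ι) is the successor set
-- of U under σ₀ alone, which keeps U reachable by a single word and makes σ₀ the
-- output of λ^X; and a disjunct of Λ^X can only fire on a Skolem value F^(s,s')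
-- that is itself such an X-part, i.e. equal to σ₀.
module Submission where

open import Defs
open import Data.Nat using (ℕ; zero; suc)
open import Relation.Binary.PropositionalEquality
  using (_≡_; _≗_; refl; sym; trans; cong; cong₂; subst; module ≡-Reasoning)
open import Data.Bool using (Bool; true; false; _∧_; _∨_; if_then_else_)
open import Data.Bool.Properties using (_≟_; ∧-zeroʳ; ∨-conicalˡ; ∨-conicalʳ; T-≡; ⇔→≡)
open import Data.Fin using (Fin; zero; suc)
open import Data.Vec using ([]; _∷_; lookup)
open import Data.Vec.Properties using (tabulate∘lookup; tabulate-cong; ≡-dec)
open import Data.List using (List; []; _∷_; map)
open import Data.List.Relation.Unary.Any using (here; satisfied)
open import Data.List.Relation.Unary.Any.Properties using (any⁺; any⁻)
open import Data.List.Membership.Propositional using (_∈_; lose)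
open import Data.List.Membership.Propositional.Properties using (∈-map⁺; ∈-++⁺ˡ; ∈-++⁺ʳ)
open import Data.Product using (_×_; _,_; ∃-syntax; proj₁; proj₂; map₂)
open import Data.Maybe using (just; nothing)
open import Function using (_∘_; case_of_; Equivalence; mk⇔)
open import Relation.Nullary.Decidable using (decidable-stable)

∧≡true⇒ : ∀ {x y} → x ∧ y ≡ true → x ≡ true × y ≡ true
∧≡true⇒ {true} {true} _ = refl , refl

∧-redundantˡ : ∀ x y → (y ≡ true → x ≡ true) → x ∧ y ≡ y
∧-redundantˡ x false _    = ∧-zeroʳ x
∧-redundantˡ x true  y⇒x rewrite y⇒x refl = refl

orFin⁺ : ∀ {k} (f : Fin k → Bool) j → f j ≡ true → orFin k f ≡ true
orFin⁺ f zero    fj rewrite fj = refl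
orFin⁺ f (suc j) fj with f zero
... | true  = refl
... | false = orFin⁺ (f ∘ suc) j fj

orFin⁻ : ∀ {k} (f : Fin k → Bool) → orFin k f ≡ true → ∃[ j ] f j ≡ true
orFin⁻ {suc k} f h with f zero in f0
... | true  = zero , f0
... | false with j , fsj ← orFin⁻ (f ∘ suc) h = suc j , fsj

orFin-false⁻ : ∀ {k} (f : Fin k → Bool) → orFin k f ≡ false → ∀ j → f j ≡ false
orFin-false⁻ f h zero    = ∨-conicalˡ (f zero) _ h
orFin-false⁻ f h (suc j) = orFin-false⁻ (f ∘ suc) (∨-conicalʳ (f zero) _ h) j

orFin-cong : ∀ {k} {f g : Fin k → Bool} → f ≗ g → orFin k f ≡ orFin k g
orFin-cong {zero}  f≗g = refl
orFin-cong {suc k} f≗g = cong₂ _∨_ (f≗g zero) (orFin-cong (f≗g ∘ suc))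

∈-allAssign : ∀ {n} (a : Assign n) → a ∈ allAssign n
∈-allAssign []                  = here refl
∈-allAssign (true ∷ a)          = ∈-++⁺ˡ (∈-map⁺ (true ∷_) (∈-allAssign a))
∈-allAssign {suc n} (false ∷ a) =
  ∈-++⁺ʳ (map (true ∷_) (allAssign n)) (∈-map⁺ (false ∷_) (∈-allAssign a))

existsB⁺ : ∀ {n} (f : Assign n → Bool) a → f a ≡ true → existsB n f ≡ true
existsB⁺ f a fa =
  Equivalence.to T-≡ (any⁺ f (lose (∈-allAssign a) (Equivalence.from T-≡ fa)))

existsB⁻ : ∀ {n} (f : Assign n → Bool) → existsB n f ≡ true → ∃[ a ] f a ≡ true
existsB⁻ {n} f h =
  map₂ (Equivalence.to T-≡) (satisfied (any⁻ f (allAssign n) (Equivalence.from T-≡ h)))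

module _ {nI nO nX k : ℕ} (A : NBA nI nO nX k) where
  open NBA A

  isTrans⁺ : ∀ {s s' σI σ σX} → δ s (σI , σ , σX) s' ≡ true → isTrans A s s' ≡ true
  isTrans⁺ {σI = σI} {σ} {σX} d =
    existsB⁺ _ σI (existsB⁺ _ σ (existsB⁺ _ σX d))

  ∃XB⇒isTrans : ∀ {s s' σI σ} → ∃XB A s s' σI σ ≡ true → isTrans A s s' ≡ true
  ∃XB⇒isTrans {s} {s'} {σI} {σ} h = isTrans⁺ (proj₂ (existsB⁻ (B A s s' σI σ) h))

  ΔX≗δX : ∀ {p U : TState A} → p ≗ U → ∀ σI σ → ΔX A p (σI , σ) ≗ δX A U (σI , σ)
  ΔX≗δX {p} p≗U σI σ i = orFin-cong λ j → begin
    isTrans A j i ∧ (p j ∧ ∃XB A j i σI σ)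
      ≡⟨ ∧-redundantˡ _ _ (∃XB⇒isTrans ∘ proj₂ ∘ ∧≡true⇒) ⟩
    p j ∧ ∃XB A j i σI σ
      ≡⟨ cong (_∧ ∃XB A j i σI σ) (p≗U j) ⟩
    _ ∎
    where open ≡-Reasoning

  cState≗tState : ∀ w t → cState A w t ≗ tState A w t
  cState≗tState w zero    zero    = refl
  cState≗tState w zero    (suc q) = refl
  cState≗tState w (suc t) = ΔX≗δX (cState≗tState w t) (proj₁ (w t)) (proj₂ (w t))

  StepFrom : TState A → Assign nI → Assign nO → Assign nX → State A → Set
  StepFrom U σI σ σX q' = ∃[ q ] (U q ≡ true × δ q (σI , σ , σX) q' ≡ true)

  stepWith⁺ : ∀ {U σI σ σX q'} → StepFrom U σI σ σX q' → stepWith A U (σI , σ) σX q' ≡ true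
  stepWith⁺ {U} {σI} {σ} {σX} {q'} (q , Uq , d) =
    orFin⁺ (λ q → U q ∧ δ q (σI , σ , σX) q') q (cong₂ _∧_ Uq d)

  stepWith⁻ : ∀ {U σI σ σX q'} → stepWith A U (σI , σ) σX q' ≡ true → StepFrom U σI σ σX q'
  stepWith⁻ {U} {σI} {σ} {σX} {q'} h =
    map₂ ∧≡true⇒ (orFin⁻ (λ q → U q ∧ δ q (σI , σ , σX) q') h)

  δX⁺ : ∀ {U σI σ σX q'} → StepFrom U σI σ σX q' → δX A U (σI , σ) q' ≡ true
  δX⁺ {U} {σI} {σ} {σX} {q'} (q , Uq , d) =
    orFin⁺ (λ q → U q ∧ existsB nX (λ σX → δ q (σI , σ , σX) q')) q
      (cong₂ _∧_ Uq (existsB⁺ (λ σX → δ q (σI , σ , σX) q') σX d))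

  δX⁻ : ∀ {U σI σ q'} → δX A U (σI , σ) q' ≡ true → ∃[ σX ] StepFrom U σI σ σX q'
  δX⁻ {U} {σI} {σ} {q'} h
    with q , Uq∧e ← orFin⁻ (λ q → U q ∧ existsB nX (λ σX → δ q (σI , σ , σX) q')) h
    with Uq , e ← ∧≡true⇒ {U q} Uq∧e =
    map₂ (λ d → q , Uq , d) (existsB⁻ (λ σX → δ q (σI , σ , σX) q') e)

  δX-nonempty⇒step : ∀ {U σI σ} → orFin (suc k) (δX A U (σI , σ)) ≡ true →
                     ∃[ σX ] ∃[ q' ] StepFrom U σI σ σX q'
  δX-nonempty⇒step {U} {σI} {σ} h
    with q' , e ← orFin⁻ (δX A U (σI , σ)) h
    with σX , st ← δX⁻ e = σX , q' , st

  ReachedBy : List (Letter nI nO nX) → TState A → Set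
  ReachedBy u U = ∀ q → U q ≡ true → Reach A u q

  reachedBy-stepWith : ∀ {u U σI σ σX} → ReachedBy u U →
                       ReachedBy ((σI , σ , σX) ∷ u) (stepWith A U (σI , σ) σX)
  reachedBy-stepWith R q' h with q , Uq , d ← stepWith⁻ h = reach∷ (R q Uq) d

  module _ (dep : AutomataDependent A) where

    StepFrom-agree : ∀ {u U σI σ σX₁ σX₂ q₁' q₂'} → ReachedBy u U →
                     StepFrom U σI σ σX₁ q₁' → StepFrom U σI σ σX₂ q₂' → σX₁ ≡ σX₂
    StepFrom-agree {u} {σI = σI} {σ} {σX₁} {σX₂} {q₁'} {q₂'} R (q₁ , U₁ , d₁) (q₂ , U₂ , d₂) =
      decidable-stable (≡-dec _≟_ σX₁ σX₂) λ σX₁≢σX₂ →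
        dep q₁ q₂ (u , R q₁ U₁ , R q₂ U₂) σI σ σX₁ σX₂ σX₁≢σX₂ ((q₁' , d₁) , (q₂' , d₂))

    δX≗stepWith : ∀ {u U σI σ σ₀ q₀'} → ReachedBy u U → StepFrom U σI σ σ₀ q₀' →
                  δX A U (σI , σ) ≗ stepWith A U (σI , σ) σ₀
    δX≗stepWith {U = U} {σI} {σ} {σ₀} R st₀ q' = ⇔→≡ (mk⇔ to (δX⁺ {U} ∘ stepWith⁻ {U}))
      where
      to : δX A U (σI , σ) q' ≡ true → stepWith A U (σI , σ) σ₀ q' ≡ true
      to h with σX , st ← δX⁻ {U} h =
        stepWith⁺ (subst (λ x → StepFrom U σI σ x q') (StepFrom-agree R st st₀) st)

    isλX-just : ∀ {u U σI σ σ₀ q₀'} → ReachedBy u U → StepFrom U σI σ σ₀ q₀' →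
                IsλX A U (σI , σ) (just σ₀)
    isλX-just {U = U} {σI} {σ} {σ₀} {q₀'} R st₀ =
      (q₀' , δX⁺ {U} st₀) , δX≗stepWith {U = U} R st₀ , unique
      where
      unique : ∀ σX → δX A U (σI , σ) ≗ stepWith A U (σI , σ) σX → σX ≡ σ₀
      unique σX δX≗ =
        StepFrom-agree R (stepWith⁻ {U} (trans (sym (δX≗ q₀')) (δX⁺ {U} st₀))) st₀

    reachedBy-δX : ∀ {u U} → ReachedBy u U → ∀ σI σ →
                   ∃[ u' ] ReachedBy u' (δX A U (σI , σ))
    reachedBy-δX {u} {U} R σI σ with orFin (suc k) (δX A U (σI , σ)) in nonempty
    ... | false = u , λ q' h →
      case trans (sym h) (orFin-false⁻ (δX A U (σI , σ)) nonempty q') of λ ()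
    ... | true with σ₀ , _ , st₀ ← δX-nonempty⇒step {U} nonempty =
      _ , λ q' h → reachedBy-stepWith {U = U} R q'
                     (trans (sym (δX≗stepWith {U = U} R st₀ q')) h)

    tState-reachedBy : ∀ w t → ∃[ u ] ReachedBy u (tState A w t)
    tState-reachedBy w zero    = [] , λ { zero _ → reach[] }
    tState-reachedBy w (suc t) =
      reachedBy-δX (proj₂ (tState-reachedBy w t)) (proj₁ (w t)) (proj₂ (w t))

    ΛX≡ : ∀ {F} → SkolemSpec A F → ∀ {p U u σI σ σ₀ q₀'} → p ≗ U → ReachedBy u U →
          StepFrom U σI σ σ₀ q₀' → ΛX A F p (σI , σ) ≡ σ₀
    ΛX≡ {F} sk {p} {U} {σI = σI} {σ} {σ₀} {q₀'} p≗U R st₀@(q₀ , Uq₀ , d₀) =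
      trans (tabulate-cong λ m → ⇔→≡ (mk⇔ (fires⇒ m) (⇒fires m))) (tabulate∘lookup σ₀)
      where
      F-agree : ∀ {s s'} → U s ≡ true → B A s s' σI σ (F s s' σI σ) ≡ true → F s s' σI σ ≡ σ₀
      F-agree Us bF = StepFrom-agree R (_ , Us , bF) st₀

      fires : Fin nX → State A → State A → Bool
      fires m s s' =
        isTrans A s s' ∧ (p s ∧ (B A s s' σI σ (F s s' σI σ) ∧ lookup (F s s' σI σ) m))

      fires⇒ : ∀ m → orFin (suc k) (λ s → orFin (suc k) (fires m s)) ≡ true →
               lookup σ₀ m ≡ true
      fires⇒ m h
        with s , h₁ ← orFin⁻ (λ s → orFin (suc k) (fires m s)) h
        with s' , h₂ ← orFin⁻ (fires m s) h₁
        with _ , h₃ ← ∧≡true⇒ {isTrans A s s'} h₂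
        with ps , h₄ ← ∧≡true⇒ {p s} h₃
        with bF , lk ← ∧≡true⇒ {B A s s' σI σ (F s s' σI σ)} h₄ =
        subst (λ x → lookup x m ≡ true) (F-agree (trans (sym (p≗U s)) ps) bF) lk

      bF₀ : B A q₀ q₀' σI σ (F q₀ q₀' σI σ) ≡ true
      bF₀ = sk q₀ q₀' σI σ (existsB⁺ (B A q₀ q₀' σI σ) σ₀ d₀)

      ⇒fires : ∀ m → lookup σ₀ m ≡ true →
               orFin (suc k) (λ s → orFin (suc k) (fires m s)) ≡ true
      ⇒fires m h =
        orFin⁺ (λ s → orFin (suc k) (fires m s)) q₀ (orFin⁺ (fires m q₀) q₀'
          (cong₂ _∧_ (isTrans⁺ d₀) (cong₂ _∧_ (trans (p≗U q₀) Uq₀) (cong₂ _∧_ bF₀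
            (subst (λ x → lookup x m ≡ true) (sym (F-agree Uq₀ bF₀)) h)))))

    isλX-circuit : ∀ {F} → SkolemSpec A F → ∀ {p U u} → p ≗ U → ReachedBy u U → ∀ σI σ →
      IsλX A U (σI , σ)
        (if orFin (suc k) (ΔX A p (σI , σ)) then just (ΛX A F p (σI , σ)) else nothing)
    isλX-circuit sk {U = U} p≗U R σI σ
      rewrite orFin-cong (ΔX≗δX p≗U σI σ)
      with orFin (suc k) (δX A U (σI , σ)) in nonempty
    ... | false = orFin-false⁻ (δX A U (σI , σ)) nonempty
    ... | true with σ₀ , _ , st₀ ← δX-nonempty⇒step {U} nonempty
      rewrite ΛX≡ sk p≗U R st₀ = isλX-just R st₀

theorem4 : {nI nO nX k : ℕ} (A : NBA nI nO nX k) →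
    AllOnAccRuns A →
    AutomataDependent A →
    (F : State A → State A → Assign nI → Assign nO → Assign nX) →
    SkolemSpec A F →
    (w : ℕ → InLetter nI nO) (t : ℕ) →
    IsλX A (tState A w t) (w t) (cOut A F w t)
theorem4 A _ dep F sk w t =
  isλX-circuit A dep sk (cState≗tState A w t) (proj₂ (tState-reachedBy A dep w t))
    (proj₁ (w t)) (proj₂ (w t))
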